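{- Let $G$ be a connected graph with $n$ vertices, and let $H$ be a connected spanning subgraph of $G$ with $H\ne G$. Then $C(H)<C(G)$.
   Context: All graphs are finite and simple. For a connected graph $G$, regard each edge as a unit resistor. $\Omega_G(i,j)$ is the effective resistance (resistance distance) between $i$ and $j$. The global cyclicity index is $$C(G)=\sum_{ij\in E(G)}\Big[\frac{1}{\Omega_G(i,j)}-1\Big].$$ -}

module Defs where

open import Data.Nat using (ℕ; zero; suc)
open import Data.Fin using (Fin; zero; suc; toℕ; _≟_)
open import Data.Fin.Properties using () renaming (_≟_ to _≟ᶠ_)
open import Data.Bool using (Bool; true; false; if_then_else_; _∧_)
open import Data.Rational using (ℚ; 0ℚ; 1ℚ; _+_; _-_; _*_; 1/_)
open import Data.Rational.Base using (≢-nonZero)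
open import Data.Rational.Properties using () renaming (_≟_ to _≟ℚ_)
open import Relation.Nullary using (yes; no; ¬_)
open import Relation.Nullary.Decidable using (⌊_⌋)
open import Relation.Binary.PropositionalEquality using (_≡_)
open import Data.Product using (∃; _×_)
import Data.Nat as ℕ

Σ : ∀ {n} → (Fin n → ℚ) → ℚ
Σ {zero}  f = 0ℚ
Σ {suc n} f = f zero + Σ (λ i → f (suc i))

record Graph (n : ℕ) : Set where
  field
    adj   : Fin n → Fin n → Bool
    sym   : ∀ i j → adj i j ≡ adj j i
    irrefl : ∀ i → adj i i ≡ false
open Graph public

data Reach {n} (G : Graph n) : Fin n → Fin n → Set where
  here : ∀ {i} → Reach G i i
  step : ∀ {i j k} → adj G i j ≡ true → Reach G j k → Reach G i k

Connected : ∀ {n} → Graph n → Set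
Connected G = ∀ i j → Reach G i j

SpanningSubgraph : ∀ {n} → Graph n → Graph n → Set
SpanningSubgraph H G = ∀ i j → adj H i j ≡ true → adj G i j ≡ true

DifferentGraph : ∀ {n} → Graph n → Graph n → Set
DifferentGraph H G = ¬ (∀ i j → adj H i j ≡ adj G i j)

laplacian : ∀ {n} → Graph n → (Fin n → ℚ) → Fin n → ℚ
laplacian G v k = Σ (λ l → if adj G k l then v k - v l else 0ℚ)

e : ∀ {n} → Fin n → Fin n → ℚ
e i k = if ⌊ i ≟ᶠ k ⌋ then 1ℚ else 0ℚ

-- Effective resistance (unit resistors): r is the effective resistance
-- between i and j iff injecting a unit current at i and extracting it at j
-- (Kirchhoff + Ohm: L v = e_i - e_j) produces a potential drop v_i - v_j = r.
-- For connected G such v exists and v_i - v_j is uniquely determined.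
IsEffRes : ∀ {n} → Graph n → Fin n → Fin n → ℚ → Set
IsEffRes {n} G i j r =
  ∃ λ (v : Fin n → ℚ) →
    (∀ k → laplacian G v k ≡ e i k - e j k) × (v i - v j ≡ r)

ResistanceDistance : ∀ {n} → Graph n → (Fin n → Fin n → ℚ) → Set
ResistanceDistance G Ω = ∀ i j → IsEffRes G i j (Ω i j)

-- Reciprocal (only applied to positive values below; 0 ↦ 0 is an
-- irrelevant convention).
recip : ℚ → ℚ
recip q with q ≟ℚ 0ℚ
... | yes _ = 0ℚ
... | no q≢0 = 1/_ q {{≢-nonZero q≢0}}

-- Global cyclicity index C(G) = Σ_{ij ∈ E(G)} (1/Ω(i,j) - 1),
-- each unordered edge counted once (i < j).
cyclicity : ∀ {n} → Graph n → (Fin n → Fin n → ℚ) → ℚ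
cyclicity G Ω =
  Σ (λ i → Σ (λ j →
    if adj G i j ∧ ⌊ toℕ i ℕ.<? toℕ j ⌋ then recip (Ω i j) - 1ℚ else 0ℚ))

-- Rayleigh monotonicity gives Ω_G ≤ Ω_H on every edge of H, so each such edge contributes at
-- least as much to C(G) as to C(H). On an edge ab of G missing from H, the unit-current
-- potential v has energy 2Ω = E_G(v) ≥ E_H(v) + 2Ω², with Ω = Ω_G(a,b) > 0; since v cannot be
-- constant on the connected graph H, E_H(v) > 0 and hence Ω < 1, so that edge adds a positive
-- term 1/Ω - 1 to C(G). Energies are computed by Green's identity E_X(x, y) = 2 x·L_X y.
module Submission where

open import Defs hiding (sym)
open import Data.Nat using (ℕ; zero; suc)
import Data.Nat as ℕ
import Data.Nat.Properties as ℕ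
open import Data.Fin using (Fin; zero; suc; toℕ)
open import Data.Fin.Properties using (¬∀⟶∃¬; all?; suc-injective; toℕ-injective) renaming (_≟_ to _≟ᶠ_)
open import Data.Bool using (Bool; true; false; if_then_else_; _∧_)
import Data.Bool.Properties as Bool
open import Data.Rational
  using (ℚ; 0ℚ; 1ℚ; _+_; _-_; _*_; -_; _<_; _≤_; positive; negative; nonNegative; nonPositive; ≢-nonZero)
open import Data.Rational.Properties
open import Data.Rational.Solver using (module +-*-Solver)
open import Algebra.Bundles using (CommutativeMonoid)
import Algebra.Properties.CommutativeSemigroup as CommSemigroupProperties
import Algebra.Properties.Group as GroupProperties
open import Relation.Binary.PropositionalEquality
open import Relation.Binary using (tri<; tri≈; tri>)
open import Relation.Nullary using (yes; no; ¬_)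
open import Relation.Nullary.Decidable using (⌊_⌋; isYes≗does; dec-true)
open import Data.Product using (∃₂; _×_; _,_)
open import Data.Sum using (inj₁; inj₂)
open import Data.Empty using (⊥-elim)
open import Function using (_∘_)

open +-*-Solver using (solve; _:+_; _:-_; _:*_; _:=_)
open CommSemigroupProperties (CommutativeMonoid.commutativeSemigroup +-0-commutativeMonoid)
  using (interchange; xy∙z≈xz∙y)
open GroupProperties +-0-group using (x∙y⁻¹≈ε⇒x≈y)

private
  variable
    n : ℕ

+-cancelʳ-≤ : ∀ r {p q} → p + r ≤ q + r → p ≤ q
+-cancelʳ-≤ r {p} {q} h = subst₂ _≤_ (cancel p) (cancel q) (+-monoˡ-≤ (- r) h)
  where
  cancel : ∀ x → x + r - r ≡ x
  cancel x = solve 2 (λ x r → x :+ r :- r := x) refl x r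

+-double-cancel-≤ : ∀ {p q} → p + p ≤ q + q → p ≤ q
+-double-cancel-≤ {p} {q} h with p ≤? q
... | yes p≤q = p≤q
... | no p≰q = ⊥-elim (<-irrefl refl (≤-<-trans h (+-mono-< (≰⇒> p≰q) (≰⇒> p≰q))))

square-nonNeg : ∀ p → 0ℚ ≤ p * p
square-nonNeg p with ≤-total 0ℚ p
... | inj₁ 0≤p = nonNegative⁻¹ _ {{nonNeg*nonNeg⇒nonNeg p {{nonNegative 0≤p}} p {{nonNegative 0≤p}}}}
-- despite its name, the library lemma concludes NonNegative
... | inj₂ p≤0 = nonNegative⁻¹ _ {{nonPos*nonPos⇒nonPos p {{nonPositive p≤0}} p {{nonPositive p≤0}}}}

square≡0⇒≡0 : ∀ p → p * p ≡ 0ℚ → p ≡ 0ℚ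
square≡0⇒≡0 p p²≡0 with <-cmp p 0ℚ
... | tri< p<0 _ _ = ⊥-elim (<-irrefl (sym p²≡0) (positive⁻¹ _ {{neg*neg⇒pos p {{negative p<0}} p {{negative p<0}}}}))
... | tri≈ _ p≡0 _ = p≡0
... | tri> _ _ p>0 = ⊥-elim (<-irrefl (sym p²≡0) (positive⁻¹ _ {{pos*pos⇒pos p {{positive p>0}} p {{positive p>0}}}}))

recip-inverseʳ : ∀ {p} → 0ℚ < p → p * recip p ≡ 1ℚ
recip-inverseʳ {p} 0<p with p ≟ 0ℚ
... | yes p≡0 = ⊥-elim (<-irrefl (sym p≡0) 0<p)
... | no p≢0 = *-inverseʳ p {{≢-nonZero p≢0}}

recip-pos : ∀ {p} → 0ℚ < p → 0ℚ < recip p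
recip-pos {p} 0<p with p ≟ 0ℚ
... | yes p≡0 = ⊥-elim (<-irrefl (sym p≡0) 0<p)
... | no p≢0 = positive⁻¹ _ {{1/pos⇒pos p {{positive 0<p}}}}

recip-antimono-≤ : ∀ {p q} → 0ℚ < p → p ≤ q → recip q ≤ recip p
recip-antimono-≤ {p} {q} 0<p p≤q = begin
  recip q                     ≡⟨ cancel (recip q) (recip p) p (recip-inverseʳ 0<p) ⟨
  recip q * recip p * p       ≤⟨ *-monoˡ-≤-nonNeg (recip q * recip p) {{nonNegative 0≤rr}} p≤q ⟩
  recip q * recip p * q       ≡⟨ cong (_* q) (*-comm (recip q) (recip p)) ⟩
  recip p * recip q * q       ≡⟨ cancel (recip p) (recip q) q (recip-inverseʳ 0<q) ⟩
  recip p                     ∎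
  where
  open ≤-Reasoning
  0<q = <-≤-trans 0<p p≤q
  0≤rr : 0ℚ ≤ recip q * recip p
  0≤rr = nonNegative⁻¹ _ {{nonNeg*nonNeg⇒nonNeg (recip q) {{nonNegative (<⇒≤ (recip-pos 0<q))}}
                                                  (recip p) {{nonNegative (<⇒≤ (recip-pos 0<p))}}}}
  cancel : ∀ x y z → z * y ≡ 1ℚ → x * y * z ≡ x
  cancel x y z zy≡1 = trans (*-assoc x y z) (trans (cong (x *_) (trans (*-comm y z) zy≡1)) (*-identityʳ x))

1<recip : ∀ {p} → 0ℚ < p → p < 1ℚ → 1ℚ < recip p
1<recip {p} 0<p p<1 =
  subst₂ _<_ (recip-inverseʳ 0<p) (*-identityˡ (recip p))
    (*-monoˡ-<-pos (recip p) {{positive (recip-pos 0<p)}} p<1)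

0<recip-1 : ∀ {p} → 0ℚ < p → p < 1ℚ → 0ℚ < recip p - 1ℚ
0<recip-1 {p} 0<p p<1 = subst (_< recip p - 1ℚ) (+-inverseʳ 1ℚ) (+-monoˡ-< (- 1ℚ) (1<recip 0<p p<1))

Σ-cong : {f g : Fin n → ℚ} → (∀ k → f k ≡ g k) → Σ f ≡ Σ g
Σ-cong {zero}  f≗g = refl
Σ-cong {suc n} f≗g = cong₂ _+_ (f≗g zero) (Σ-cong (f≗g ∘ suc))

Σ-0 : Σ {n} (λ _ → 0ℚ) ≡ 0ℚ
Σ-0 {zero}  = refl
Σ-0 {suc n} = trans (+-identityˡ _) (Σ-0 {n})

Σ-+ : (f g : Fin n → ℚ) → Σ (λ k → f k + g k) ≡ Σ f + Σ g
Σ-+ {zero}  f g = refl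
Σ-+ {suc n} f g =
  trans (cong (f zero + g zero +_) (Σ-+ (f ∘ suc) (g ∘ suc))) (interchange (f zero) (g zero) _ _)

Σ-neg : (f : Fin n → ℚ) → Σ (λ k → - f k) ≡ - Σ f
Σ-neg {zero}  f = refl
Σ-neg {suc n} f = trans (cong (- f zero +_) (Σ-neg (f ∘ suc))) (sym (neg-distrib-+ (f zero) _))

Σ-*ˡ : ∀ c (f : Fin n → ℚ) → Σ (λ k → c * f k) ≡ c * Σ f
Σ-*ˡ {zero}  c f = sym (*-zeroʳ c)
Σ-*ˡ {suc n} c f = trans (cong (c * f zero +_) (Σ-*ˡ c (f ∘ suc))) (sym (*-distribˡ-+ c _ _))

Σ-swap : ∀ {m} (F : Fin n → Fin m → ℚ) → Σ (λ k → Σ (λ l → F k l)) ≡ Σ (λ l → Σ (λ k → F k l))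
Σ-swap {zero}  {m} F = sym (Σ-0 {m})
Σ-swap {suc n}     F =
  trans (cong (Σ (F zero) +_) (Σ-swap (F ∘ suc))) (sym (Σ-+ (F zero) (λ l → Σ (λ k → F (suc k) l))))

Σ-supported : ∀ (i : Fin n) f → (∀ k → ¬ k ≡ i → f k ≡ 0ℚ) → Σ f ≡ f i
Σ-supported {suc n} zero f off =
  trans (cong (f zero +_) (trans (Σ-cong (λ k → off (suc k) λ ())) (Σ-0 {n}))) (+-identityʳ (f zero))
Σ-supported {suc n} (suc i) f off =
  trans (cong (_+ Σ (f ∘ suc)) (off zero λ ()))
        (trans (+-identityˡ _) (Σ-supported i (f ∘ suc) (λ k k≢i → off (suc k) (k≢i ∘ suc-injective))))

Σ-mono : {f g : Fin n → ℚ} → (∀ k → f k ≤ g k) → Σ f ≤ Σ g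
Σ-mono {zero}  f≤g = ≤-refl
Σ-mono {suc n} f≤g = +-mono-≤ (f≤g zero) (Σ-mono (f≤g ∘ suc))

Σ-nonNeg : {f : Fin n → ℚ} → (∀ k → 0ℚ ≤ f k) → 0ℚ ≤ Σ f
Σ-nonNeg {n} {f} f≥0 = subst (_≤ Σ f) (Σ-0 {n}) (Σ-mono f≥0)

Σ-mono-point : ∀ {f g : Fin n → ℚ} {c} → (∀ k → f k ≤ g k) →
               ∀ a → f a + c ≤ g a → Σ f + c ≤ Σ g
Σ-mono-point {suc n} {f} {g} {c} f≤g zero gap = begin
  f zero + Σ (f ∘ suc) + c   ≡⟨ xy∙z≈xz∙y (f zero) _ c ⟩
  f zero + c + Σ (f ∘ suc)   ≤⟨ +-mono-≤ gap (Σ-mono (f≤g ∘ suc)) ⟩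
  g zero + Σ (g ∘ suc)       ∎
  where open ≤-Reasoning
Σ-mono-point {suc n} {f} {g} {c} f≤g (suc a) gap = begin
  f zero + Σ (f ∘ suc) + c   ≡⟨ +-assoc (f zero) _ c ⟩
  f zero + (Σ (f ∘ suc) + c) ≤⟨ +-mono-≤ (f≤g zero) (Σ-mono-point (f≤g ∘ suc) a gap) ⟩
  g zero + Σ (g ∘ suc)       ∎
  where open ≤-Reasoning

Σ-mono-pair : ∀ {f g : Fin n → ℚ} {a b c d} → ¬ a ≡ b → (∀ k → f k ≤ g k) →
              f a + c ≤ g a → f b + d ≤ g b → Σ f + (c + d) ≤ Σ g
Σ-mono-pair {a = zero} {zero} a≢b _ _ _ = ⊥-elim (a≢b refl)
Σ-mono-pair {suc n} {f} {g} {zero} {suc b} {c} {d} _ f≤g gapa gapb = begin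
  f zero + Σ (f ∘ suc) + (c + d)   ≡⟨ interchange (f zero) _ c d ⟩
  f zero + c + (Σ (f ∘ suc) + d)   ≤⟨ +-mono-≤ gapa (Σ-mono-point (f≤g ∘ suc) b gapb) ⟩
  g zero + Σ (g ∘ suc)             ∎
  where open ≤-Reasoning
Σ-mono-pair {f = f} {g} {suc a} {zero} {c} {d} a≢b f≤g gapa gapb =
  subst (λ x → Σ f + x ≤ Σ g) (+-comm d c) (Σ-mono-pair (a≢b ∘ sym) f≤g gapb gapa)
Σ-mono-pair {suc n} {f} {g} {suc a} {suc b} {c} {d} a≢b f≤g gapa gapb = begin
  f zero + Σ (f ∘ suc) + (c + d)   ≡⟨ +-assoc (f zero) _ (c + d) ⟩
  f zero + (Σ (f ∘ suc) + (c + d)) ≤⟨ +-mono-≤ (f≤g zero) (Σ-mono-pair (a≢b ∘ cong suc) (f≤g ∘ suc) gapa gapb) ⟩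
  g zero + Σ (g ∘ suc)             ∎
  where open ≤-Reasoning

e-diag : ∀ (i : Fin n) → e i i ≡ 1ℚ
e-diag i with i ≟ᶠ i
... | yes _ = refl
... | no i≢i = ⊥-elim (i≢i refl)

e-offDiag : ∀ {i k : Fin n} → ¬ i ≡ k → e i k ≡ 0ℚ
e-offDiag {i = i} {k} i≢k with i ≟ᶠ k
... | yes i≡k = ⊥-elim (i≢k i≡k)
... | no _ = refl

Σ-*-e : ∀ (x : Fin n → ℚ) i → Σ (λ k → x k * e i k) ≡ x i
Σ-*-e x i = trans (Σ-supported i _ offDiag) (trans (cong (x i *_) (e-diag i)) (*-identityʳ (x i)))
  where
  offDiag : ∀ k → ¬ k ≡ i → x k * e i k ≡ 0ℚ
  offDiag k k≢i = trans (cong (x k *_) (e-offDiag (k≢i ∘ sym))) (*-zeroʳ (x k))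

Σ-*-e-e : ∀ (x : Fin n → ℚ) i j → Σ (λ k → x k * (e i k - e j k)) ≡ x i - x j
Σ-*-e-e x i j = begin
  Σ (λ k → x k * (e i k - e j k))           ≡⟨ Σ-cong (λ k → distrib (x k) (e i k) (e j k)) ⟩
  Σ (λ k → x k * e i k + - (x k * e j k))   ≡⟨ Σ-+ (λ k → x k * e i k) (λ k → - (x k * e j k)) ⟩
  Σ (λ k → x k * e i k) + Σ (λ k → - (x k * e j k))
                                            ≡⟨ cong (Σ (λ k → x k * e i k) +_) (Σ-neg (λ k → x k * e j k)) ⟩
  Σ (λ k → x k * e i k) - Σ (λ k → x k * e j k) ≡⟨ cong₂ _-_ (Σ-*-e x i) (Σ-*-e x j) ⟩
  x i - x j                                 ∎
  where
  open ≡-Reasoning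
  distrib : ∀ a b c → a * (b - c) ≡ a * b + - (a * c)
  distrib a b c = trans (*-distribˡ-+ a b (- c)) (cong (a * b +_) (sym (neg-distribʳ-* a c)))

ΣΣ : (Fin n → Fin n → ℚ) → ℚ
ΣΣ F = Σ (λ k → Σ (λ l → F k l))

ΣΣ-0 : ΣΣ {n} (λ _ _ → 0ℚ) ≡ 0ℚ
ΣΣ-0 {n} = trans (Σ-cong {n} {g = λ _ → 0ℚ} (λ _ → Σ-0 {n})) (Σ-0 {n})

ΣΣ-mono-point : ∀ {F F' : Fin n → Fin n → ℚ} {c} → (∀ k l → F k l ≤ F' k l) →
                ∀ a b → F a b + c ≤ F' a b → ΣΣ F + c ≤ ΣΣ F'
ΣΣ-mono-point F≤F' a b gap = Σ-mono-point (λ k → Σ-mono (F≤F' k)) a (Σ-mono-point (F≤F' a) b gap)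

masked : (Fin n → Fin n → Bool) → (Fin n → Fin n → ℚ) → Fin n → Fin n → ℚ
masked p F k l = if p k l then F k l else 0ℚ

ΣΣ-masked-< : ∀ {p q : Fin n → Fin n → Bool} {F G : Fin n → Fin n → ℚ} {a b} →
  (∀ k l → p k l ≡ true → q k l ≡ true) →
  (∀ k l → p k l ≡ true → F k l ≤ G k l) →
  (∀ k l → q k l ≡ true → p k l ≡ false → 0ℚ < G k l) →
  q a b ≡ true → p a b ≡ false → ΣΣ (masked p F) < ΣΣ (masked q G)
ΣΣ-masked-< {p = p} {q} {F} {G} {a} {b} p⇒q F≤G G>0 qab pab = begin-strict
  ΣΣ (masked p F)            ≡⟨ +-identityʳ _ ⟨
  ΣΣ (masked p F) + 0ℚ       <⟨ +-monoʳ-< (ΣΣ (masked p F)) (G>0 a b qab pab) ⟩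
  ΣΣ (masked p F) + G a b    ≤⟨ ΣΣ-mono-point masked-≤ a b gap ⟩
  ΣΣ (masked q G)            ∎
  where
  open ≤-Reasoning
  masked-≤ : ∀ k l → masked p F k l ≤ masked q G k l
  masked-≤ k l with p k l in pkl | q k l in qkl
  ... | true  | true  = F≤G k l pkl
  ... | true  | false with () ← trans (sym (p⇒q k l pkl)) qkl
  ... | false | true  = <⇒≤ (G>0 k l qkl pkl)
  ... | false | false = ≤-refl
  gap : masked p F a b + G a b ≤ masked q G a b
  gap rewrite pab | qab = ≤-reflexive (+-identityˡ (G a b))

edge⇒≢ : ∀ (X : Graph n) {a b} → adj X a b ≡ true → ¬ a ≡ b
edge⇒≢ X {a} ab refl with () ← trans (sym ab) (irrefl X a)

edge-sym : ∀ (X : Graph n) {a b x} → adj X a b ≡ x → adj X b a ≡ x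
edge-sym X {a} {b} ab = trans (Graph.sym X b a) ab

edgeSum : Graph n → (Fin n → Fin n → ℚ) → ℚ
edgeSum X F = ΣΣ (masked (adj X) F)

module _ (X : Graph n) where

  edgeSum-cong : ∀ {F F' : Fin n → Fin n → ℚ} → (∀ k l → F k l ≡ F' k l) → edgeSum X F ≡ edgeSum X F'
  edgeSum-cong F≗F' = Σ-cong (λ k → Σ-cong (λ l → cong (if adj X k l then_else 0ℚ) (F≗F' k l)))

  edgeSum-+ : ∀ (F F' : Fin n → Fin n → ℚ) →
              edgeSum X (λ k l → F k l + F' k l) ≡ edgeSum X F + edgeSum X F'
  edgeSum-+ F F' =
    trans (Σ-cong (λ k → trans (Σ-cong (λ l → if-+ (adj X k l))) (Σ-+ (masked (adj X) F k) (masked (adj X) F' k))))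
          (Σ-+ (λ k → Σ (masked (adj X) F k)) (λ k → Σ (masked (adj X) F' k)))
    where
    if-+ : ∀ {k l} b → (if b then F k l + F' k l else 0ℚ) ≡ (if b then F k l else 0ℚ) + (if b then F' k l else 0ℚ)
    if-+ true  = refl
    if-+ false = sym (+-identityˡ 0ℚ)

  edgeSum-nonNeg : ∀ {F : Fin n → Fin n → ℚ} → (∀ k l → 0ℚ ≤ F k l) → 0ℚ ≤ edgeSum X F
  edgeSum-nonNeg F≥0 = Σ-nonNeg (λ k → Σ-nonNeg (λ l → if-nonNeg (adj X k l) (F≥0 k l)))
    where
    if-nonNeg : ∀ {x} b → 0ℚ ≤ x → 0ℚ ≤ (if b then x else 0ℚ)
    if-nonNeg true  0≤x = 0≤x
    if-nonNeg false _   = ≤-refl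

  edgeSum-transpose : ∀ (F : Fin n → Fin n → ℚ) → edgeSum X (λ k l → F l k) ≡ edgeSum X F
  edgeSum-transpose F = trans (Σ-swap (masked (adj X) (λ k l → F l k)))
    (Σ-cong (λ k → Σ-cong (λ l → cong (if_then F k l else 0ℚ) (Graph.sym X l k))))

  edgeSum-rows : ∀ (x : Fin n → ℚ) (F : Fin n → Fin n → ℚ) →
                 edgeSum X (λ k l → x k * F k l) ≡ Σ (λ k → x k * Σ (masked (adj X) F k))
  edgeSum-rows x F = Σ-cong (λ k → trans (Σ-cong (λ l → if-*ˡ (adj X k l))) (Σ-*ˡ (x k) (masked (adj X) F k)))
    where
    if-*ˡ : ∀ {k l} b → (if b then x k * F k l else 0ℚ) ≡ x k * (if b then F k l else 0ℚ)
    if-*ˡ true  = refl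
    if-*ˡ {k} false = sym (*-zeroʳ (x k))

  edgeSum-term : ∀ {F : Fin n → Fin n → ℚ} → (∀ k l → 0ℚ ≤ F k l) →
                 ∀ {a b} → adj X a b ≡ true → F a b ≤ edgeSum X F
  edgeSum-term {F} F≥0 {a} {b} ab = begin
    F a b                              ≡⟨ +-identityˡ (F a b) ⟨
    0ℚ + F a b                         ≡⟨ cong (_+ F a b) (ΣΣ-0 {n}) ⟨
    ΣΣ {n} (λ _ _ → 0ℚ) + F a b        ≤⟨ ΣΣ-mono-point 0≤masked a b gap ⟩
    edgeSum X F                        ∎
    where
    open ≤-Reasoning
    0≤masked : ∀ k l → 0ℚ ≤ masked (adj X) F k l
    0≤masked k l with adj X k l
    ... | true  = F≥0 k l
    ... | false = ≤-refl
    gap : 0ℚ + F a b ≤ masked (adj X) F a b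
    gap rewrite ab = ≤-reflexive (+-identityˡ (F a b))

dirichlet : Graph n → (Fin n → ℚ) → (Fin n → ℚ) → ℚ
dirichlet X x y = edgeSum X (λ k l → (x k - x l) * (y k - y l))

-- Each unordered edge occurs twice in the ordered double sum, hence the factor 2.
dirichlet-green : ∀ (X : Graph n) x y →
  dirichlet X x y ≡ Σ (λ k → x k * laplacian X y k) + Σ (λ k → x k * laplacian X y k)
dirichlet-green X x y = begin
  dirichlet X x y                                  ≡⟨ edgeSum-cong X split ⟩
  edgeSum X (λ k l → x k * (y k - y l) + x l * (y l - y k))  ≡⟨ edgeSum-+ X _ _ ⟩
  edgeSum X half + edgeSum X (λ k l → half l k)    ≡⟨ cong (edgeSum X half +_) (edgeSum-transpose X half) ⟩
  edgeSum X half + edgeSum X half                  ≡⟨ cong₂ _+_ (edgeSum-rows X x _) (edgeSum-rows X x _) ⟩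
  Σ (λ k → x k * laplacian X y k) + Σ (λ k → x k * laplacian X y k) ∎
  where
  open ≡-Reasoning
  half : Fin _ → Fin _ → ℚ
  half k l = x k * (y k - y l)
  split : ∀ k l → (x k - x l) * (y k - y l) ≡ x k * (y k - y l) + x l * (y l - y k)
  split k l = solve 4 (λ a b c d → (a :- b) :* (c :- d) := a :* (c :- d) :+ b :* (d :- c)) refl (x k) (x l) (y k) (y l)

Potential : Graph n → Fin n → Fin n → (Fin n → ℚ) → Set
Potential X i j v = ∀ k → laplacian X v k ≡ e i k - e j k

dirichlet-potential : ∀ (X : Graph n) {i j} x y → Potential X i j y →
                      dirichlet X x y ≡ (x i - x j) + (x i - x j)
dirichlet-potential X {i} {j} x y Ly = trans (dirichlet-green X x y) (cong₂ _+_ drop drop)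
  where
  drop : Σ (λ k → x k * laplacian X y k) ≡ x i - x j
  drop = trans (Σ-cong (λ k → cong (x k *_) (Ly k))) (Σ-*-e-e x i j)

ConstantOnEdges : Graph n → (Fin n → ℚ) → Set
ConstantOnEdges X v = ∀ k l → adj X k l ≡ true → v k ≡ v l

dirichlet≤0⇒constantOnEdges : ∀ (X : Graph n) v → dirichlet X v v ≤ 0ℚ → ConstantOnEdges X v
dirichlet≤0⇒constantOnEdges X v E≤0 k l kl = x∙y⁻¹≈ε⇒x≈y (v k) (v l) (square≡0⇒≡0 _ square≡0)
  where
  square≡0 : (v k - v l) * (v k - v l) ≡ 0ℚ
  square≡0 = ≤-antisym (≤-trans (edgeSum-term X (λ k l → square-nonNeg (v k - v l)) kl) E≤0)
                       (square-nonNeg (v k - v l))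

constantOnEdges-reach : ∀ {X : Graph n} {v} → ConstantOnEdges X v → ∀ {a b} → Reach X a b → v a ≡ v b
constantOnEdges-reach c here                 = refl
constantOnEdges-reach c (step {i} {j} ij r) = trans (c i j ij) (constantOnEdges-reach c r)

constantOnEdges⇒laplacian≡0 : ∀ {X : Graph n} {v} → ConstantOnEdges X v → ∀ k → laplacian X v k ≡ 0ℚ
constantOnEdges⇒laplacian≡0 {n} {X} {v} c k = trans (Σ-cong term≡0) (Σ-0 {n})
  where
  term≡0 : ∀ l → (if adj X k l then v k - v l else 0ℚ) ≡ 0ℚ
  term≡0 l with adj X k l in kl
  ... | true  = trans (cong (_- v l) (c k l kl)) (+-inverseʳ (v l))
  ... | false = refl

potential-drop-pos : ∀ (X : Graph n) {i j} v → Potential X i j v → ¬ i ≡ j → 0ℚ < v i - v j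
potential-drop-pos X {i} {j} v Lv i≢j with v i - v j ≤? 0ℚ
... | no  drop≰0 = ≰⇒> drop≰0
... | yes drop≤0 = ⊥-elim (0≢1 (trans (sym (constantOnEdges⇒laplacian≡0 {X = X} flat i)) (trans (Lv i) unitCurrent)))
  where
  flat : ConstantOnEdges X v
  flat = dirichlet≤0⇒constantOnEdges X v (begin
    dirichlet X v v             ≡⟨ dirichlet-potential X v v Lv ⟩
    (v i - v j) + (v i - v j)   ≤⟨ +-mono-≤ drop≤0 drop≤0 ⟩
    0ℚ + 0ℚ                     ≡⟨ +-identityʳ 0ℚ ⟩
    0ℚ                          ∎)
    where open ≤-Reasoning
  unitCurrent : e i i - e j i ≡ 1ℚ - 0ℚ
  unitCurrent = cong₂ _-_ (e-diag i) (e-offDiag (i≢j ∘ sym))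
  0≢1 : ¬ 0ℚ ≡ 1ℚ - 0ℚ
  0≢1 ()

module _ (H G : Graph n) (H⊆G : SpanningSubgraph H G) where

  private
    masked-mono : ∀ {F} → (∀ k l → 0ℚ ≤ F k l) → ∀ k l → masked (adj H) F k l ≤ masked (adj G) F k l
    masked-mono F≥0 k l with adj H k l in hkl
    ... | true rewrite H⊆G k l hkl = ≤-refl
    ... | false with adj G k l
    ...   | true  = F≥0 k l
    ...   | false = ≤-refl

  edgeSum-mono-⊆ : ∀ {F} → (∀ k l → 0ℚ ≤ F k l) → edgeSum H F ≤ edgeSum G F
  edgeSum-mono-⊆ F≥0 = Σ-mono (λ k → Σ-mono (masked-mono F≥0 k))

  edgeSum-gap-⊆ : ∀ {F} → (∀ k l → 0ℚ ≤ F k l) → ∀ {a b} → adj G a b ≡ true → adj H a b ≡ false →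
                  edgeSum H F + (F a b + F b a) ≤ edgeSum G F
  edgeSum-gap-⊆ {F} F≥0 {a} {b} gab hab =
    Σ-mono-pair (edge⇒≢ G gab) (λ k → Σ-mono (masked-mono F≥0 k))
      (rowGap gab hab) (rowGap (edge-sym G gab) (edge-sym H hab))
    where
    rowGap : ∀ {k l} → adj G k l ≡ true → adj H k l ≡ false →
             Σ (masked (adj H) F k) + F k l ≤ Σ (masked (adj G) F k)
    rowGap {k} {l} gkl hkl = Σ-mono-point (masked-mono F≥0 k) l gap
      where
      gap : masked (adj H) F k l + F k l ≤ masked (adj G) F k l
      gap rewrite gkl | hkl = ≤-reflexive (+-identityˡ (F k l))

  -- Rayleigh monotonicity: the energy of w - v over H is nonnegative, and expands to 2 (Ω_H - Ω_G).
  rayleigh-monotonicity : ∀ {i j} v w → Potential G i j v → Potential H i j w → v i - v j ≤ w i - w j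
  rayleigh-monotonicity {i} {j} v w Lv Lw = +-double-cancel-≤ (+-cancelʳ-≤ (ΩG + ΩG) (begin
    (ΩG + ΩG) + (ΩG + ΩG)                      ≡⟨ +-identityˡ _ ⟨
    0ℚ + ((ΩG + ΩG) + (ΩG + ΩG))
      ≤⟨ +-monoˡ-≤ _ (edgeSum-nonNeg H (λ k l → square-nonNeg (δ k l))) ⟩
    edgeSum H (λ k l → δ k l * δ k l) + ((ΩG + ΩG) + (ΩG + ΩG))
      ≡⟨ cong (λ d → edgeSum H (λ k l → δ k l * δ k l) + (d + d)) (dirichlet-potential H v w Lw) ⟨
    edgeSum H (λ k l → δ k l * δ k l) + (dirichlet H v w + dirichlet H v w) ≡⟨ expand ⟩
    dirichlet H w w + dirichlet H v v          ≡⟨ cong (_+ dirichlet H v v) (dirichlet-potential H w w Lw) ⟩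
    (ΩH + ΩH) + dirichlet H v v
      ≤⟨ +-monoʳ-≤ (ΩH + ΩH) (edgeSum-mono-⊆ (λ k l → square-nonNeg (v k - v l))) ⟩
    (ΩH + ΩH) + dirichlet G v v                ≡⟨ cong ((ΩH + ΩH) +_) (dirichlet-potential G v v Lv) ⟩
    (ΩH + ΩH) + (ΩG + ΩG)                      ∎))
    where
    open ≤-Reasoning
    ΩG = v i - v j
    ΩH = w i - w j
    δ : Fin n → Fin n → ℚ
    δ k l = (w k - w l) - (v k - v l)
    expand : edgeSum H (λ k l → δ k l * δ k l) + (dirichlet H v w + dirichlet H v w) ≡ dirichlet H w w + dirichlet H v v
    expand = begin-equality
      edgeSum H (λ k l → δ k l * δ k l) + (dirichlet H v w + dirichlet H v w)
        ≡⟨ cong (edgeSum H (λ k l → δ k l * δ k l) +_) (edgeSum-+ H _ _) ⟨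
      edgeSum H (λ k l → δ k l * δ k l) + edgeSum H (λ k l → (v k - v l) * (w k - w l) + (v k - v l) * (w k - w l))
        ≡⟨ edgeSum-+ H _ _ ⟨
      edgeSum H (λ k l → δ k l * δ k l + ((v k - v l) * (w k - w l) + (v k - v l) * (w k - w l)))
        ≡⟨ edgeSum-cong H (λ k l → square (w k - w l) (v k - v l)) ⟩
      edgeSum H (λ k l → (w k - w l) * (w k - w l) + (v k - v l) * (v k - v l))
        ≡⟨ edgeSum-+ H _ _ ⟩
      dirichlet H w w + dirichlet H v v ∎
      where
      square : ∀ p q → (p - q) * (p - q) + (q * p + q * p) ≡ p * p + q * q
      square = solve 2 (λ p q → (p :- q) :* (p :- q) :+ (q :* p :+ q :* p) := p :* p :+ q :* q) refl

  missingEdge-drop<1 : Connected H → ∀ {a b} → adj G a b ≡ true → adj H a b ≡ false →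
                       ∀ v → Potential G a b v → v a - v b < 1ℚ
  missingEdge-drop<1 H-conn {a} {b} gab hab v Lv with 1ℚ ≤? v a - v b
  ... | no  1≰Ω = ≰⇒> 1≰Ω
  ... | yes 1≤Ω = ⊥-elim (<-irrefl (sym Ω≡0) 0<Ω)
    where
    Ω = v a - v b
    0<Ω : 0ℚ < Ω
    0<Ω = potential-drop-pos G v Lv (edge⇒≢ G gab)
    Ω≤Ω² : Ω ≤ Ω * Ω
    Ω≤Ω² = subst (_≤ Ω * Ω) (*-identityʳ Ω) (*-monoˡ-≤-nonNeg Ω {{nonNegative (<⇒≤ 0<Ω)}} 1≤Ω)
    energyH≤0 : dirichlet H v v ≤ 0ℚ
    energyH≤0 = +-cancelʳ-≤ (Ω + Ω) (begin
      dirichlet H v v + (Ω + Ω)           ≤⟨ +-monoʳ-≤ (dirichlet H v v) (+-mono-≤ Ω≤Ω² Ω≤Ω²) ⟩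
      dirichlet H v v + (Ω * Ω + Ω * Ω)   ≡⟨ cong (λ s → dirichlet H v v + (Ω * Ω + s)) flip ⟩
      dirichlet H v v + (Ω * Ω + (v b - v a) * (v b - v a))
                                          ≤⟨ edgeSum-gap-⊆ (λ k l → square-nonNeg (v k - v l)) gab hab ⟩
      dirichlet G v v                     ≡⟨ dirichlet-potential G v v Lv ⟩
      Ω + Ω                               ≡⟨ +-identityˡ (Ω + Ω) ⟨
      0ℚ + (Ω + Ω)                        ∎)
      where
      open ≤-Reasoning
      flip : Ω * Ω ≡ (v b - v a) * (v b - v a)
      flip = solve 2 (λ x y → (x :- y) :* (x :- y) := (y :- x) :* (y :- x)) refl (v a) (v b)
    Ω≡0 : Ω ≡ 0ℚ
    Ω≡0 = trans (cong (_- v b) (constantOnEdges-reach {X = H} (dirichlet≤0⇒constantOnEdges H v energyH≤0) (H-conn a b)))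
                (+-inverseʳ (v b))

module _ (H G : Graph n) {ΩH ΩG : Fin n → Fin n → ℚ} (H⊆G : SpanningSubgraph H G)
         (resH : ResistanceDistance H ΩH) (resG : ResistanceDistance G ΩG) where

  resistance-pos : ∀ {k l} → adj G k l ≡ true → 0ℚ < ΩG k l
  resistance-pos {k} {l} gkl with v , Lv , drop≡Ω ← resG k l =
    subst (0ℚ <_) drop≡Ω (potential-drop-pos G v Lv (edge⇒≢ G gkl))

  conductance-mono : ∀ {k l} → adj H k l ≡ true → recip (ΩH k l) ≤ recip (ΩG k l)
  conductance-mono {k} {l} hkl with v , Lv , v-drop ← resG k l | w , Lw , w-drop ← resH k l =
    recip-antimono-≤ (resistance-pos (H⊆G k l hkl))
      (subst₂ _≤_ v-drop w-drop (rayleigh-monotonicity H G H⊆G v w Lv Lw))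

  0<recip-1-on-missingEdge : Connected H → ∀ {k l} → adj G k l ≡ true → adj H k l ≡ false →
                              0ℚ < recip (ΩG k l) - 1ℚ
  0<recip-1-on-missingEdge H-conn {k} {l} gkl hkl with v , Lv , drop≡Ω ← resG k l =
    0<recip-1 (resistance-pos gkl) (subst (_< 1ℚ) drop≡Ω (missingEdge-drop<1 H G H⊆G H-conn gkl hkl v Lv))

implication-≢ : ∀ {x y : Bool} → (x ≡ true → y ≡ true) → ¬ x ≡ y → x ≡ false × y ≡ true
implication-≢ {false} {true}  _   _   = refl , refl
implication-≢ {false} {false} _   x≢y = ⊥-elim (x≢y refl)
implication-≢ {true}  {true}  _   x≢y = ⊥-elim (x≢y refl)
implication-≢ {true}  {false} x⇒y _ with () ← x⇒y refl

∧-mono-true : ∀ {x y z} → (x ≡ true → y ≡ true) → x ∧ z ≡ true → y ∧ z ≡ true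
∧-mono-true {true} x⇒y xz rewrite x⇒y refl = xz

∧-true⇒ˡ : ∀ {x y} → x ∧ y ≡ true → x ≡ true
∧-true⇒ˡ {true} _ = refl

∧-false-true⇒ : ∀ {x y z} → x ∧ z ≡ false → y ∧ z ≡ true → x ≡ false
∧-false-true⇒ {false}                _  _  = refl
∧-false-true⇒ {true} {_}     {true}  () _
∧-false-true⇒ {true} {false} {false} _  ()
∧-false-true⇒ {true} {true}  {false} _  ()

missingEdge : ∀ {H G : Graph n} → SpanningSubgraph H G → DifferentGraph H G →
              ∃₂ λ a b → adj G a b ≡ true × adj H a b ≡ false
missingEdge {n} {H} {G} H⊆G H≠G
  with a , rowsDiffer ← ¬∀⟶∃¬ n _ (λ i → all? (λ j → adj H i j Bool.≟ adj G i j)) H≠G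
  with b , entriesDiffer ← ¬∀⟶∃¬ n _ (λ j → adj H a j Bool.≟ adj G a j) rowsDiffer
  with hab , gab ← implication-≢ (H⊆G a b) entriesDiffer
  = a , b , gab , hab

orient-toℕ< : ∀ (R : Fin n → Fin n → Set) → (∀ {a b} → R a b → R b a) → (∀ {a} → ¬ R a a) →
              ∀ {a b} → R a b → ∃₂ λ a b → toℕ a ℕ.< toℕ b × R a b
orient-toℕ< R R-sym R-irrefl {a} {b} r with ℕ.<-cmp (toℕ a) (toℕ b)
... | tri< a<b _ _ = a , b , a<b , r
... | tri≈ _ a≡b _ = ⊥-elim (R-irrefl (subst (R a) (sym (toℕ-injective a≡b)) r))
... | tri> _ _ b<a = b , a , b<a , R-sym r

upperEdges : Graph n → Fin n → Fin n → Bool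
upperEdges X i j = adj X i j ∧ ⌊ toℕ i ℕ.<? toℕ j ⌋

mainTheorem4 : (n : ℕ) (G H : Graph n) (ΩG ΩH : Fin n → Fin n → ℚ) →
    Connected G → Connected H → SpanningSubgraph H G → DifferentGraph H G →
    ResistanceDistance G ΩG → ResistanceDistance H ΩH →
    cyclicity H ΩH < cyclicity G ΩG
mainTheorem4 n G H ΩG ΩH _ H-conn H⊆G H≠G resG resH
  with a , b , gab , hab ← missingEdge {H = H} {G} H⊆G H≠G
  with a , b , a<b , gab , hab ← orient-toℕ< (λ k l → adj G k l ≡ true × adj H k l ≡ false)
         (λ (g , h) → edge-sym G g , edge-sym H h) (λ (g , _) → edge⇒≢ G g refl) (gab , hab)
  = ΣΣ-masked-< {p = upperEdges H} {upperEdges G} {λ k l → recip (ΩH k l) - 1ℚ} {λ k l → recip (ΩG k l) - 1ℚ}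
        (λ k l → ∧-mono-true (H⊆G k l))
        (λ k l hkl → +-monoˡ-≤ (- 1ℚ) (conductance-mono H G H⊆G resH resG (∧-true⇒ˡ hkl)))
        (λ k l gkl hkl → 0<recip-1-on-missingEdge H G H⊆G resH resG H-conn (∧-true⇒ˡ gkl) (∧-false-true⇒ hkl gkl))
        (cong₂ _∧_ gab (trans (isYes≗does (toℕ a ℕ.<? toℕ b)) (dec-true (toℕ a ℕ.<? toℕ b) a<b)))
        (cong (_∧ ⌊ toℕ a ℕ.<? toℕ b ⌋) hab)
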